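{- Let $G$ be a finite abelian group and $S\subseteq G$ with $0\in S$ a $2$-separable subset. Suppose $A$ is a $2$-atom of $S$ which is a subgroup with $|A|\ge 3$. Then there exists $s\in S$, $s\neq 0$, whose order is at most $\kappa_2(S)$.
   Context: For $S\subseteq G$ with $0\in S$, $\langle S\rangle$ is the subgroup generated by $S$. $S$ is $2$-separable if there exists $X\subseteq\langle S\rangle$ with $|X|\ge 2$ and $|X+S|\le|\langle S\rangle|-2$; then $\kappa_2(S)=\min\{|X+S|-|X| : X\subseteq\langle S\rangle,\ |X|\ge 2,\ |X+S|\le|\langle S\rangle|-2\}$. A set attaining this minimum is a $2$-fragment; a $2$-fragment of minimum cardinality is a $2$-atom of $S$. -}

module Defs where

open import Data.Nat using (ℕ; zero; suc; _+_; _≤_; _<_)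
open import Data.Fin using (Fin; _≟_)
open import Data.Bool using (Bool; true; false; _∧_; _∨_)
open import Data.Vec using (tabulate; lookup)
open import Data.Fin.Subset using (Subset; _∈_; _⊆_; ∣_∣)
open import Data.Product using (Σ; _×_; ∃; ∃-syntax)
open import Relation.Nullary using (¬_)
open import Relation.Nullary.Decidable using (⌊_⌋)
open import Relation.Binary.PropositionalEquality using (_≡_)
open import Algebra.Structures using (IsAbelianGroup)

-- A finite abelian group of order n, realised (up to isomorphism) on the
-- carrier Fin n, with propositional equality.
record FinAbGroup (n : ℕ) : Set where
  field
    _⊕_   : Fin n → Fin n → Fin n
    e     : Fin n
    ⊖_    : Fin n → Fin n
    isAbelianGroup : IsAbelianGroup _≡_ _⊕_ e ⊖_

module _ {n : ℕ} (G : FinAbGroup n) where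
  open FinAbGroup G

  anyFin : {m : ℕ} → (Fin m → Bool) → Bool
  anyFin {zero}  f = false
  anyFin {suc m} f = f Fin.zero ∨ anyFin (λ i → f (Fin.suc i))

  sumset : Subset n → Subset n → Subset n
  sumset X S = tabulate (λ z → anyFin (λ x → anyFin (λ s →
                 lookup X x ∧ lookup S s ∧ ⌊ (x ⊕ s) ≟ z ⌋)))

  IsSubgroup : Subset n → Set
  IsSubgroup H = (e ∈ H)
               × (∀ {x y} → x ∈ H → y ∈ H → (x ⊕ y) ∈ H)
               × (∀ {x} → x ∈ H → (⊖ x) ∈ H)

  IsGeneratedBy : Subset n → Subset n → Set
  IsGeneratedBy S H = IsSubgroup H × S ⊆ H
                    × (∀ K → IsSubgroup K → S ⊆ K → H ⊆ K)

  -- X ⊆ ⟨S⟩ (= H), |X| ≥ 2, |X + S| ≤ |⟨S⟩| - 2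
  Admissible : Subset n → Subset n → Subset n → Set
  Admissible S H X = X ⊆ H × 2 ≤ ∣ X ∣ × ∣ sumset X S ∣ + 2 ≤ ∣ H ∣

  TwoSeparable : Subset n → Subset n → Set
  TwoSeparable S H = ∃[ X ] Admissible S H X

  IsKappa2 : Subset n → Subset n → ℕ → Set
  IsKappa2 S H k = (∃[ X ] (Admissible S H X × ∣ sumset X S ∣ ≡ ∣ X ∣ + k))
                 × (∀ X → Admissible S H X → ∣ X ∣ + k ≤ ∣ sumset X S ∣)

  IsTwoFragment : Subset n → Subset n → ℕ → Subset n → Set
  IsTwoFragment S H k X = Admissible S H X × ∣ sumset X S ∣ ≡ ∣ X ∣ + k

  IsTwoAtom : Subset n → Subset n → ℕ → Subset n → Set
  IsTwoAtom S H k X = IsTwoFragment S H k X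
                    × (∀ Y → IsTwoFragment S H k Y → ∣ X ∣ ≤ ∣ Y ∣)

  mul : ℕ → Fin n → Fin n
  mul zero    x = e
  mul (suc m) x = x ⊕ mul m x

  IsOrder : Fin n → ℕ → Set
  IsOrder x o = 0 < o × mul o x ≡ e × (∀ m → 0 < m → mul m x ≡ e → o ≤ m)

{-# OPTIONS --safe #-}
module Submission where

-- If S meets the subgroup 2-atom A only in 0, then (A ∖ {0}) + S ⊆ (A + S) ∖ {0}, so A ∖ {0}
-- is a 2-fragment smaller than A, which is impossible. Hence some s ≠ 0 of S lies in A, and
-- the order of s is at most |A|. Finally |A| ≤ κ₂(S): S ⊈ A, since otherwise
-- ⟨S⟩ ⊆ A ⊆ A + S would contradict |A + S| ≤ |⟨S⟩| - 2; and for t ∈ S ∖ A the cosets A and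
-- A + t are disjoint subsets of A + S, so |A| + κ₂(S) = |A + S| ≥ 2|A|.

open import Defs
open import Data.Nat using (ℕ; zero; suc; _+_; _∸_; _≤_; _<_; z≤n; s≤s; s≤s⁻¹; z<s)
open import Data.Nat.Properties
  using ( ≤-refl; ≤-trans; ≤-antisym; <⇒≤; <⇒≱; ≮⇒≥; n≮n; m≤n⇒m≤1+n; m≤n⇒m<n∨m≡n
        ; m<m+n; +-monoˡ-≤; +-cancelˡ-≤; m∸n≤m; m∸n+n≡m; m<n⇒0<n∸m; module ≤-Reasoning)
open import Data.Bool using (Bool; T)
open import Data.Bool.Properties using (T-≡; T-∧; T-∨)
open import Data.Fin using (Fin) renaming (zero to fzero; suc to fsuc)
open import Data.Fin.Properties using (_≟_; any?; suc-injective)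
open import Data.Fin.Subset using (Subset; inside; outside; _∈_; _∉_; _⊆_; _-_; ∣_∣; ⁅_⁆)
open import Data.Fin.Subset.Properties
  using (_∈?_; x∈p∧x≢y⇒x∈p-y; x∈p⇒∣p-x∣<∣p∣; p─⊥≡p; p─q⊆p; p⊆q⇒∣p∣≤∣q∣)
open import Data.Vec using ([]; _∷_; lookup; here; there)
open import Data.Vec.Properties using (lookup∘tabulate; []=⇒lookup; lookup⇒[]=)
open import Data.List using (List; []; _∷_; length; map; _++_; applyUpTo)
open import Data.List.Properties using (length-map; length-++; length-applyUpTo)
open import Data.List.Relation.Unary.All as All using (All; []; _∷_)
import Data.List.Relation.Unary.All.Properties as All
open import Data.List.Relation.Unary.AllPairs using ([]; _∷_)
open import Data.List.Relation.Unary.Unique.Propositional using (Unique)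
import Data.List.Relation.Unary.Unique.Propositional.Properties as Unique
open import Data.List.Relation.Binary.Disjoint.Propositional using (Disjoint)
open import Data.List.Membership.Propositional.Properties using (∈-map⁻)
open import Data.Product using (_×_; ∃-syntax; _,_)
open import Data.Sum using (_⊎_; inj₁; inj₂; [_,_]′)
open import Function using (_∘_; Equivalence)
open import Level using (0ℓ)
open import Relation.Nullary using (¬_; yes; no; contradiction)
open import Relation.Nullary.Decidable using (_×-dec_; ¬?; toWitness; fromWitness)
open import Relation.Unary using (Decidable)
open import Relation.Binary.PropositionalEquality
  using (_≡_; _≢_; refl; sym; trans; cong; cong₂; subst; ≢-sym; module ≡-Reasoning)
open import Algebra.Bundles using (Group)
open import Algebra.Structures using (IsAbelianGroup)
import Algebra.Properties.Group as GroupProperties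

open Equivalence using (to; from)

∈⇒T-lookup : ∀ {m} {p : Subset m} {x} → x ∈ p → T (lookup p x)
∈⇒T-lookup x∈p = from T-≡ ([]=⇒lookup x∈p)

T-lookup⇒∈ : ∀ {m} {p : Subset m} {x} → T (lookup p x) → x ∈ p
T-lookup⇒∈ t = lookup⇒[]= _ _ (to T-≡ t)

x∈p-y⇒x≢y : ∀ {m} {p : Subset m} {x y} → x ∈ p - y → x ≢ y
x∈p-y⇒x≢y {p = _ ∷ _} {fzero} {fzero} ()
x∈p-y⇒x≢y {p = _ ∷ _} {fsuc x} {fzero} _ ()
x∈p-y⇒x≢y {p = _ ∷ _} {fsuc x} {fsuc y} (there x∈p-y) = x∈p-y⇒x≢y x∈p-y ∘ suc-injective

x∈p⇒suc∣p-x∣≡∣p∣ : ∀ {m} {p : Subset m} {x} → x ∈ p → suc ∣ p - x ∣ ≡ ∣ p ∣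
x∈p⇒suc∣p-x∣≡∣p∣ {p = inside  ∷ p} here          = cong (suc ∘ ∣_∣) (p─⊥≡p p)
x∈p⇒suc∣p-x∣≡∣p∣ {p = inside  ∷ p} (there x∈p) = cong suc (x∈p⇒suc∣p-x∣≡∣p∣ x∈p)
x∈p⇒suc∣p-x∣≡∣p∣ {p = outside ∷ p} (there x∈p) = x∈p⇒suc∣p-x∣≡∣p∣ x∈p

length≤∣p∣ : ∀ {m} {p : Subset m} {xs : List (Fin m)} →
             Unique xs → All (_∈ p) xs → length xs ≤ ∣ p ∣
length≤∣p∣ [] [] = z≤n
length≤∣p∣ {p = p} {x ∷ xs} (x∉xs ∷ unique) (x∈p ∷ xs⊆p) = begin
  suc (length xs) ≤⟨ s≤s (length≤∣p∣ unique (All.zipWith xs⊆p-x (x∉xs , xs⊆p))) ⟩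
  suc ∣ p - x ∣   ≡⟨ x∈p⇒suc∣p-x∣≡∣p∣ x∈p ⟩
  ∣ p ∣           ∎
  where
  open ≤-Reasoning
  xs⊆p-x : ∀ {y} → x ≢ y × y ∈ p → y ∈ p - x
  xs⊆p-x (x≢y , y∈p) = x∈p∧x≢y⇒x∈p-y y∈p (≢-sym x≢y)

toList : ∀ {m} → Subset m → List (Fin m)
toList []            = []
toList (outside ∷ p) = map fsuc (toList p)
toList (inside  ∷ p) = fzero ∷ map fsuc (toList p)

length-toList : ∀ {m} (p : Subset m) → length (toList p) ≡ ∣ p ∣
length-toList []            = refl
length-toList (outside ∷ p) = trans (length-map fsuc (toList p)) (length-toList p)
length-toList (inside  ∷ p) = cong suc (trans (length-map fsuc (toList p)) (length-toList p))

All-∈-toList : ∀ {m} (p : Subset m) → All (_∈ p) (toList p)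
All-∈-toList []            = []
All-∈-toList (outside ∷ p) = All.map⁺ (All.map there (All-∈-toList p))
All-∈-toList (inside  ∷ p) = here ∷ All.map⁺ (All.map there (All-∈-toList p))

toList-Unique : ∀ {m} (p : Subset m) → Unique (toList p)
toList-Unique []            = []
toList-Unique (outside ∷ p) = Unique.map⁺ suc-injective (toList-Unique p)
toList-Unique (inside  ∷ p) =
  All.map⁺ (All.universal (λ _ ()) (toList p)) ∷ Unique.map⁺ suc-injective (toList-Unique p)

∣p∣+∣p∣≤∣q∣ : ∀ {m} {p q : Subset m} (f : Fin m → Fin m) → (∀ {x y} → f x ≡ f y → x ≡ y) →
              p ⊆ q → (∀ {x} → x ∈ p → f x ∈ q) → (∀ {x y} → x ∈ p → y ∈ p → f x ≢ y) →
              ∣ p ∣ + ∣ p ∣ ≤ ∣ q ∣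
∣p∣+∣p∣≤∣q∣ {p = p} {q} f f-injective p⊆q f[p]⊆q f[p]∩p≡∅ = begin
  ∣ p ∣ + ∣ p ∣                  ≡⟨ sym (cong₂ _+_ (length-toList p) length-f[p]) ⟩
  length xs + length (map f xs)  ≡⟨ sym (length-++ xs) ⟩
  length (xs ++ map f xs)        ≤⟨ length≤∣p∣ unique (All.++⁺ (All.map p⊆q xs⊆p) f[xs]⊆q) ⟩
  ∣ q ∣                          ∎
  where
  open ≤-Reasoning
  xs : List (Fin _)
  xs = toList p
  xs⊆p : All (_∈ p) xs
  xs⊆p = All-∈-toList p
  length-f[p] : length (map f xs) ≡ ∣ p ∣
  length-f[p] = trans (length-map f xs) (length-toList p)
  f[xs]⊆q : All (_∈ q) (map f xs)
  f[xs]⊆q = All.map⁺ (All.map f[p]⊆q xs⊆p)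
  disjoint : Disjoint xs (map f xs)
  disjoint (v∈xs , v∈f[xs]) with x , x∈xs , refl ← ∈-map⁻ f v∈f[xs] =
    f[p]∩p≡∅ (All.lookup xs⊆p x∈xs) (All.lookup xs⊆p v∈xs) refl
  unique : Unique (xs ++ map f xs)
  unique = Unique.++⁺ (toList-Unique p) (Unique.map⁺ f-injective (toList-Unique p)) disjoint

applyUpTo-pigeonhole : ∀ {m} {p : Subset m} (f : ℕ → Fin m) N → (∀ {i} → i < N → f i ∈ p) →
                       (∀ {i j} → i < j → j < N → f i ≢ f j) → N ≤ ∣ p ∣
applyUpTo-pigeonhole f N f[N]⊆p f-injective =
  subst (_≤ _) (length-applyUpTo f N)
    (length≤∣p∣ (Unique.applyUpTo⁺₁ f N f-injective) (All.applyUpTo⁺₁ f N f[N]⊆p))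

module _ {p} {P : ℕ → Set p} (P? : Decidable P) where

  noPositive≤⊎leastPositive≤ : ∀ m → (∀ {j} → 0 < j → j ≤ m → ¬ P j)
                                 ⊎ ∃[ o ] (0 < o × o ≤ m × P o × (∀ {j} → 0 < j → j < o → ¬ P j))
  noPositive≤⊎leastPositive≤ zero = inj₁ (λ 0<j j≤0 → contradiction j≤0 (<⇒≱ 0<j))
  noPositive≤⊎leastPositive≤ (suc m) with noPositive≤⊎leastPositive≤ m
  ... | inj₂ (o , 0<o , o≤m , Po , least) = inj₂ (o , 0<o , m≤n⇒m≤1+n o≤m , Po , least)
  ... | inj₁ none with P? (suc m)
  ...   | yes Psm = inj₂ (suc m , z<s , ≤-refl , Psm , λ 0<j j<1+m → none 0<j (s≤s⁻¹ j<1+m))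
  ...   | no ¬Psm = inj₁ λ 0<j j≤1+m →
    [ none 0<j ∘ s≤s⁻¹ , (λ { refl → ¬Psm }) ]′ (m≤n⇒m<n∨m≡n j≤1+m)

module _ {n : ℕ} (G : FinAbGroup n) where
  open FinAbGroup G
  open IsAbelianGroup isAbelianGroup using (assoc; identityˡ; identityʳ; isGroup)

  group : Group 0ℓ 0ℓ
  group = record { Carrier = Fin n ; _≈_ = _≡_ ; _∙_ = _⊕_ ; ε = e ; _⁻¹ = ⊖_ ; isGroup = isGroup }

  open GroupProperties group using (∙-cancelʳ; \\-leftDividesʳ)

  ∈-subgroup-cancelˡ : ∀ {K} → IsSubgroup G K → ∀ {x y} → x ∈ K → (x ⊕ y) ∈ K → y ∈ K
  ∈-subgroup-cancelˡ (_ , ⊕-closed , ⊖-closed) {x} {y} x∈K x⊕y∈K =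
    subst (_∈ _) (\\-leftDividesʳ x y) (⊕-closed (⊖-closed x∈K) x⊕y∈K)

  mul-+ : ∀ i j x → mul G (i + j) x ≡ mul G i x ⊕ mul G j x
  mul-+ zero    j x = sym (identityˡ _)
  mul-+ (suc i) j x = trans (cong (x ⊕_) (mul-+ i j x)) (sym (assoc x _ _))

  mul-∈ : ∀ {K} → IsSubgroup G K → ∀ {x} → x ∈ K → ∀ m → mul G m x ∈ K
  mul-∈ (e∈K , _) x∈K zero              = e∈K
  mul-∈ K≤G@(_ , ⊕-closed , _) x∈K (suc m) = ⊕-closed x∈K (mul-∈ K≤G x∈K m)

  mul-injective-below-order : ∀ {x N} → (∀ {j} → 0 < j → j ≤ N → mul G j x ≢ e) →
                              ∀ {i j} → i < j → j ≤ N → mul G i x ≢ mul G j x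
  mul-injective-below-order {x} noZero {i} {j} i<j j≤N ix≡jx =
    noZero (m<n⇒0<n∸m i<j) (≤-trans (m∸n≤m j i) j≤N) (∙-cancelʳ (mul G i x) _ _ (begin
      mul G (j ∸ i) x ⊕ mul G i x ≡⟨ sym (mul-+ (j ∸ i) i x) ⟩
      mul G (j ∸ i + i) x         ≡⟨ cong (λ r → mul G r x) (m∸n+n≡m (<⇒≤ i<j)) ⟩
      mul G j x                   ≡⟨ sym ix≡jx ⟩
      mul G i x                   ≡⟨ sym (identityˡ _) ⟩
      e ⊕ mul G i x               ∎))
    where open ≡-Reasoning

  order≤∣K∣ : ∀ {K} → IsSubgroup G K → ∀ {x} → x ∈ K → ∃[ o ] (IsOrder G x o × o ≤ ∣ K ∣)
  order≤∣K∣ {K} K≤G {x} x∈K with noPositive≤⊎leastPositive≤ (λ j → mul G j x ≟ e) ∣ K ∣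
  ... | inj₂ (o , 0<o , o≤∣K∣ , ox≡e , least) =
    o , (0<o , ox≡e , λ j 0<j jx≡e → ≮⇒≥ (λ j<o → least 0<j j<o jx≡e)) , o≤∣K∣
  ... | inj₁ noZero = contradiction
    (applyUpTo-pigeonhole (λ i → mul G i x) (suc ∣ K ∣) (λ {i} _ → mul-∈ K≤G x∈K i)
      (λ i<j j≤∣K∣ → mul-injective-below-order noZero i<j (s≤s⁻¹ j≤∣K∣)))
    (n≮n ∣ K ∣)

  T-anyFin⁻ : ∀ {m} {f : Fin m → Bool} → T (anyFin G f) → ∃[ i ] T (f i)
  T-anyFin⁻ {suc m} t with to T-∨ t
  ... | inj₁ t₀ = fzero , t₀
  ... | inj₂ t₊ with i , tᵢ ← T-anyFin⁻ t₊ = fsuc i , tᵢ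

  T-anyFin⁺ : ∀ {m} {f : Fin m → Bool} i → T (f i) → T (anyFin G f)
  T-anyFin⁺ fzero    t = from T-∨ (inj₁ t)
  T-anyFin⁺ (fsuc i) t = from T-∨ (inj₂ (T-anyFin⁺ i t))

  ∈-sumset⁻ : ∀ {X S z} → z ∈ sumset G X S → ∃[ x ] ∃[ s ] (x ∈ X × s ∈ S × x ⊕ s ≡ z)
  ∈-sumset⁻ {z = z} z∈X+S
    with x , t  ← T-anyFin⁻ (subst T (lookup∘tabulate _ z) (∈⇒T-lookup z∈X+S))
    with s , t′ ← T-anyFin⁻ t
    with x∈X , t″ ← to T-∧ t′
    with s∈S , x⊕s≡z ← to T-∧ t″
    = x , s , T-lookup⇒∈ x∈X , T-lookup⇒∈ s∈S , toWitness x⊕s≡z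

  ∈-sumset⁺ : ∀ {X S x s} → x ∈ X → s ∈ S → (x ⊕ s) ∈ sumset G X S
  ∈-sumset⁺ {x = x} {s} x∈X s∈S = T-lookup⇒∈ (subst T (sym (lookup∘tabulate _ (x ⊕ s)))
    (T-anyFin⁺ x (T-anyFin⁺ s
      (from T-∧ (∈⇒T-lookup x∈X , from T-∧ (∈⇒T-lookup s∈S , fromWitness refl))))))

  ⊆-sumset : ∀ {X S} → e ∈ S → X ⊆ sumset G X S
  ⊆-sumset e∈S {x} x∈X = subst (_∈ _) (identityʳ x) (∈-sumset⁺ x∈X e∈S)

  ∣K∣+∣K∣≤∣K+S∣ : ∀ {K S t} → IsSubgroup G K → e ∈ S → t ∈ S → t ∉ K →
                  ∣ K ∣ + ∣ K ∣ ≤ ∣ sumset G K S ∣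
  ∣K∣+∣K∣≤∣K+S∣ {t = t} K≤G e∈S t∈S t∉K =
    ∣p∣+∣p∣≤∣q∣ (_⊕ t) (∙-cancelʳ t _ _) (⊆-sumset e∈S) (λ x∈K → ∈-sumset⁺ x∈K t∈S)
      (λ x∈K y∈K x⊕t≡y → t∉K (∈-subgroup-cancelˡ K≤G x∈K (subst (_∈ _) (sym x⊕t≡y) y∈K)))

  sumset-punctured : ∀ {K S} → IsSubgroup G K → (∀ {s} → s ∈ S → s ∈ K → s ≡ e) →
                     sumset G (K - e) S ⊆ sumset G K S - e
  sumset-punctured {K} K≤G@(e∈K , _) S∩K⊆⁅e⁆ {z} z∈
    with x , s , x∈K-e , s∈S , x⊕s≡z ← ∈-sumset⁻ z∈ =
    x∈p∧x≢y⇒x∈p-y (subst (_∈ _) x⊕s≡z (∈-sumset⁺ x∈K s∈S)) z≢e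
    where
    x∈K : x ∈ K
    x∈K = p─q⊆p K ⁅ e ⁆ x∈K-e
    z≢e : z ≢ e
    z≢e z≡e = x∈p-y⇒x≢y x∈K-e x≡e
      where
      x⊕s≡e : x ⊕ s ≡ e
      x⊕s≡e = trans x⊕s≡z z≡e
      s≡e : s ≡ e
      s≡e = S∩K⊆⁅e⁆ s∈S (∈-subgroup-cancelˡ K≤G x∈K (subst (_∈ K) (sym x⊕s≡e) e∈K))
      x≡e : x ≡ e
      x≡e = trans (sym (identityʳ x)) (trans (cong (x ⊕_) (sym s≡e)) x⊕s≡e)

  admissible-subgroup⇒S⊈K : ∀ {S H K} → e ∈ S → IsGeneratedBy G S H → IsSubgroup G K →
                             Admissible G S H K → ∃[ t ] (t ∈ S × t ∉ K)
  admissible-subgroup⇒S⊈K {S} {H} {K} e∈S (_ , _ , ⟨S⟩-least) K≤G (_ , _ , ∣K+S∣+2≤∣H∣)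
    with any? (λ t → t ∈? S ×-dec ¬? (t ∈? K))
  ... | yes t∈S∖K = t∈S∖K
  ... | no S⊈K = contradiction ∣K+S∣<∣K+S∣ (n≮n ∣ sumset G K S ∣)
    where
    S⊆K : S ⊆ K
    S⊆K {t} t∈S with t ∈? K
    ... | yes t∈K = t∈K
    ... | no t∉K = contradiction (t , t∈S , t∉K) S⊈K
    ∣K+S∣<∣K+S∣ : ∣ sumset G K S ∣ < ∣ sumset G K S ∣
    ∣K+S∣<∣K+S∣ = begin-strict
      ∣ sumset G K S ∣      <⟨ m<m+n _ z<s ⟩
      ∣ sumset G K S ∣ + 2  ≤⟨ ∣K+S∣+2≤∣H∣ ⟩
      ∣ H ∣                 ≤⟨ p⊆q⇒∣p∣≤∣q∣ (⟨S⟩-least K K≤G S⊆K) ⟩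
      ∣ K ∣                 ≤⟨ p⊆q⇒∣p∣≤∣q∣ (⊆-sumset {K} e∈S) ⟩
      ∣ sumset G K S ∣      ∎
      where open ≤-Reasoning

  subgroup-fragment⇒∣K∣≤k : ∀ {S H K k} → e ∈ S → IsGeneratedBy G S H → IsSubgroup G K →
                             IsTwoFragment G S H k K → ∣ K ∣ ≤ k
  subgroup-fragment⇒∣K∣≤k {K = K} e∈S ⟨S⟩≡H K≤G (K-admissible , ∣K+S∣≡∣K∣+k)
    with t , t∈S , t∉K ← admissible-subgroup⇒S⊈K e∈S ⟨S⟩≡H K≤G K-admissible =
    +-cancelˡ-≤ ∣ K ∣ _ _ (subst (∣ K ∣ + ∣ K ∣ ≤_) ∣K+S∣≡∣K∣+k (∣K∣+∣K∣≤∣K+S∣ K≤G e∈S t∈S t∉K))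

  punctured-subgroup-fragment : ∀ {S H K k} → e ∈ S → IsKappa2 G S H k → IsSubgroup G K →
                                3 ≤ ∣ K ∣ → (∀ {s} → s ∈ S → s ∈ K → s ≡ e) →
                                IsTwoFragment G S H k K → IsTwoFragment G S H k (K - e)
  punctured-subgroup-fragment {S} {H} {K} {k} e∈S (_ , κ₂-least) K≤G@(e∈K , _) 3≤∣K∣ S∩K⊆⁅e⁆
    ((K⊆H , _ , ∣K+S∣+2≤∣H∣) , ∣K+S∣≡∣K∣+k) =
    X-admissible , ≤-antisym ∣X+S∣≤∣X∣+k (κ₂-least X X-admissible)
    where
    X : Subset n
    X = K - e
    ∣X∣+1≡∣K∣ : suc ∣ X ∣ ≡ ∣ K ∣
    ∣X∣+1≡∣K∣ = x∈p⇒suc∣p-x∣≡∣p∣ e∈K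
    ∣X+S∣<∣K+S∣ : ∣ sumset G X S ∣ < ∣ sumset G K S ∣
    ∣X+S∣<∣K+S∣ = begin
      suc ∣ sumset G X S ∣      ≤⟨ s≤s (p⊆q⇒∣p∣≤∣q∣ (sumset-punctured K≤G S∩K⊆⁅e⁆)) ⟩
      suc ∣ sumset G K S - e ∣  ≡⟨ x∈p⇒suc∣p-x∣≡∣p∣ (⊆-sumset {K} e∈S e∈K) ⟩
      ∣ sumset G K S ∣          ∎
      where open ≤-Reasoning
    ∣X+S∣≤∣X∣+k : ∣ sumset G X S ∣ ≤ ∣ X ∣ + k
    ∣X+S∣≤∣X∣+k = s≤s⁻¹ (begin
      suc ∣ sumset G X S ∣  ≤⟨ ∣X+S∣<∣K+S∣ ⟩
      ∣ sumset G K S ∣      ≡⟨ ∣K+S∣≡∣K∣+k ⟩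
      ∣ K ∣ + k             ≡⟨ cong (_+ k) (sym ∣X∣+1≡∣K∣) ⟩
      suc ∣ X ∣ + k         ∎)
      where open ≤-Reasoning
    X-admissible : Admissible G S H X
    X-admissible = K⊆H ∘ p─q⊆p K ⁅ e ⁆
                 , s≤s⁻¹ (subst (3 ≤_) (sym ∣X∣+1≡∣K∣) 3≤∣K∣)
                 , ≤-trans (+-monoˡ-≤ 2 (<⇒≤ ∣X+S∣<∣K+S∣)) ∣K+S∣+2≤∣H∣

  subgroup-atom⇒nonzero∈S∩K : ∀ {S H K k} → e ∈ S → IsKappa2 G S H k → IsTwoAtom G S H k K →
                               IsSubgroup G K → 3 ≤ ∣ K ∣ → ∃[ s ] (s ∈ S × s ∈ K × s ≢ e)
  subgroup-atom⇒nonzero∈S∩K {S} {K = K} e∈S κ₂ (K-fragment , K-least) K≤G@(e∈K , _) 3≤∣K∣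
    with any? (λ s → s ∈? S ×-dec s ∈? K ×-dec ¬? (s ≟ e))
  ... | yes s∈S∩K∖e = s∈S∩K∖e
  ... | no ∄s = contradiction
    (K-least (K - e) (punctured-subgroup-fragment e∈S κ₂ K≤G 3≤∣K∣ S∩K⊆⁅e⁆ K-fragment))
    (<⇒≱ (x∈p⇒∣p-x∣<∣p∣ e∈K))
    where
    S∩K⊆⁅e⁆ : ∀ {s} → s ∈ S → s ∈ K → s ≡ e
    S∩K⊆⁅e⁆ {s} s∈S s∈K with s ≟ e
    ... | yes s≡e = s≡e
    ... | no s≢e = contradiction (s , s∈S , s∈K , s≢e) ∄s

lemma2p10 : ∀ {n} (G : FinAbGroup n) (S H A : Subset n) (k : ℕ)
    → FinAbGroup.e G ∈ S
    → IsGeneratedBy G S H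
    → TwoSeparable G S H
    → IsKappa2 G S H k
    → IsTwoAtom G S H k A
    → IsSubgroup G A
    → 3 ≤ ∣ A ∣
    → ∃[ s ] (s ∈ S × ¬ (s ≡ FinAbGroup.e G) × ∃[ o ] (IsOrder G s o × o ≤ k))
lemma2p10 G S H A k e∈S ⟨S⟩≡H _ κ₂ A-atom@(A-fragment , _) A≤G 3≤∣A∣
  with s , s∈S , s∈A , s≢e ← subgroup-atom⇒nonzero∈S∩K G e∈S κ₂ A-atom A≤G 3≤∣A∣
  with o , o-order , o≤∣A∣ ← order≤∣K∣ G A≤G s∈A =
  s , s∈S , s≢e , o , o-order ,
  ≤-trans o≤∣A∣ (subgroup-fragment⇒∣K∣≤k G e∈S ⟨S⟩≡H A≤G A-fragment)
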